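{- Let $G$ be a multigraph on $n$ vertices whose edges are colored with $n-1$ colors so that the $n-1$ color classes are $n-1$ copies of one and the same spanning tree $T$ (i.e. for every edge $uv$ of $T$, $G$ has exactly $n-1$ parallel edges between $u$ and $v$, one of each color, and $G$ has no other edges). Then $G$ can be decomposed into $n-1$ pairwise edge-disjoint rainbow spanning trees (so Rota's Basis Conjecture holds for $G$).
   Context: A spanning tree of a graph on $n$ vertices is an acyclic set of $n-1$ edges meeting every vertex. A subgraph is rainbow if all its edges have distinct colors. -}

module Defs where

open import Data.Nat using (ℕ; zero; suc; _∸_)
open import Data.Fin using (Fin; zero; suc; inject₁; fromℕ)
open import Data.Product using (Σ; ∃; _×_; _,_; proj₁; proj₂)
open import Data.Sum using (_⊎_)
open import Data.Empty using (⊥)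
open import Relation.Nullary using (¬_)
open import Relation.Binary.PropositionalEquality using (_≡_)
open import Function.Definitions using (Injective; Bijective)

-- An edge of a multigraph on vertex set Fin n is recorded by its pair of
-- endpoints (unordered reading: see Joins).  Multigraph edges are indexed
-- by an arbitrary type E with an endpoint map E → Fin n × Fin n, so
-- parallel edges are distinct indices with the same endpoints.
VEdge : ℕ → Set
VEdge n = Fin n × Fin n

Joins : ∀ {n} → VEdge n → Fin n → Fin n → Set
Joins (a , b) x y = (a ≡ x × b ≡ y) ⊎ (a ≡ y × b ≡ x)

-- A cycle in a list of edges (indexed by Fin m, endpoints given by ends):
-- a closed walk v₀ e₁ v₁ … e_{k+1} v_{k+1} = v₀ of length k+1 ≥ 1
-- with pairwise distinct edges and pairwise distinct vertices v₀ … v_k.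
-- (Length 1 = a loop, length 2 = two parallel edges.)
record Cycle {n m : ℕ} (ends : Fin m → VEdge n) : Set where
  field
    k     : ℕ
    vtx   : Fin (suc (suc k)) → Fin n
    edg   : Fin (suc k) → Fin m
    closed   : vtx zero ≡ vtx (fromℕ (suc k))
    vtx-inj  : Injective _≡_ _≡_ (λ i → vtx (inject₁ i))
    edg-inj  : Injective _≡_ _≡_ edg
    steps    : ∀ i → Joins (ends (edg i)) (vtx (inject₁ i)) (vtx (suc i))

Acyclic : ∀ {n m} → (Fin m → VEdge n) → Set
Acyclic ends = ¬ Cycle ends

record IsSpanningTree {n : ℕ} {E : Set} (ends : E → VEdge n)
                      (t : Fin (n ∸ 1) → E) : Set where
  field
    distinct : Injective _≡_ _≡_ t
    acyclic  : Acyclic (λ j → ends (t j))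
    spanning : ∀ (v : Fin n) → ∃ λ j → (proj₁ (ends (t j)) ≡ v) ⊎ (proj₂ (ends (t j)) ≡ v)

IsRainbow : ∀ {m : ℕ} {E C : Set} (colour : E → C) (t : Fin m → E) → Set
IsRainbow colour t = Injective _≡_ _≡_ (λ j → colour (t j))

-- An edge of G is a pair
-- (i , c) = "the copy of colour c of the i-th edge of T".
GEdge : ℕ → Set
GEdge n = Fin (n ∸ 1) × Fin (n ∸ 1)

G-ends : ∀ {n} → (Fin (n ∸ 1) → VEdge n) → GEdge n → VEdge n
G-ends T (i , c) = T i

G-colour : ∀ {n} → GEdge n → Fin (n ∸ 1)
G-colour (i , c) = c

-- A decomposition of G into n-1 pairwise edge-disjoint rainbow spanning
-- trees: trees t₀ … t_{n-2}, each a rainbow spanning tree of G, such that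
-- every edge of G lies in exactly one of them at exactly one position,
-- i.e. (k , j) ↦ t k j is a bijection onto the edge set of G.
record RainbowDecomposition {n : ℕ} (T : Fin (n ∸ 1) → VEdge n) : Set where
  field
    tree      : Fin (n ∸ 1) → Fin (n ∸ 1) → GEdge n
    isTree    : ∀ k → IsSpanningTree (G-ends T) (tree k)
    rainbow   : ∀ k → IsRainbow (G-colour {n}) (tree k)
    partition : Bijective _≡_ _≡_ (λ (p : Fin (n ∸ 1) × Fin (n ∸ 1)) → tree (proj₁ p) (proj₂ p))

{-# OPTIONS --safe #-}
module Submission where

-- A Latin square L on
-- the n-1 indices yields the decomposition: the k-th tree takes edge j of
-- T in colour L k j.  Every tree has the same underlying edge set as T,
-- hence is a spanning tree; it is rainbow because L k is injective; and
-- each edge (j , c) of G is used exactly once because every column of L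
-- is a permutation.  The Cayley table of ℤ/(n-1), like that of any
-- quasigroup, is such a Latin square.

open import Defs
open import Data.Nat using (ℕ; _∸_; _+_; _<_; NonZero)
open import Data.Nat.Properties using (+-comm; +-assoc; m∸n+n≡m; m+[n∸m]≡n; <⇒≤)
open import Data.Nat.DivMod using (_%_; _mod_; %-distribˡ-+; m%n%n≡m%n; [m+n]%n≡m%n; m<n⇒m%n≡m; m%n<n)
open import Data.Fin using (Fin; toℕ)
open import Data.Fin.Properties using (toℕ-injective; toℕ-fromℕ<; toℕ<n; nonZeroIndex)
open import Data.Product using (_×_; _,_; proj₁; uncurry)
open import Function using (id; flip)
open import Algebra.Core using (Op₂)
open import Algebra.Structures using (IsQuasigroup)
open import Function.Consequences.Propositional
  using (inverseᵇ⇒bijective; strictlyInverseˡ⇒inverseˡ; strictlyInverseʳ⇒inverseʳ)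
open import Relation.Binary.PropositionalEquality
  using (_≡_; sym; trans; cong; cong₂; isEquivalence; module ≡-Reasoning)

open ≡-Reasoning

[m%d+n]%d≡[m+n]%d : ∀ m n d .{{_ : NonZero d}} → (m % d + n) % d ≡ (m + n) % d
[m%d+n]%d≡[m+n]%d m n d = begin
  (m % d + n) % d           ≡⟨ %-distribˡ-+ (m % d) n d ⟩
  (m % d % d + n % d) % d   ≡⟨ cong (λ r → (r + n % d) % d) (m%n%n≡m%n m d) ⟩
  (m % d + n % d) % d       ≡⟨ %-distribˡ-+ m n d ⟨
  (m + n) % d               ∎

[[x+a]%d+b]%d≡x : ∀ {x a b d} .{{_ : NonZero d}} → x < d → a + b ≡ d →
                  ((x + a) % d + b) % d ≡ x
[[x+a]%d+b]%d≡x {x} {a} {b} {d} x<d a+b≡d = begin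
  ((x + a) % d + b) % d   ≡⟨ [m%d+n]%d≡[m+n]%d (x + a) b d ⟩
  (x + a + b) % d         ≡⟨ cong (_% d) (trans (+-assoc x a b) (cong (x +_) a+b≡d)) ⟩
  (x + d) % d             ≡⟨ [m+n]%n≡m%n x d ⟩
  x % d                   ≡⟨ m<n⇒m%n≡m x<d ⟩
  x                       ∎

toℕ-mod : ∀ x d .{{_ : NonZero d}} → toℕ (x mod d) ≡ x % d
toℕ-mod x d = toℕ-fromℕ< (m%n<n x d)

module _ {m : ℕ} where

  infixl 6 _⊕_ _⊖_

  -- The NonZero m instance is taken from the right operand j, so that
  -- i ⊕ j ⊖ j, i ⊖ j ⊕ j and the cancellation lemmas all use the same one
  -- (instances drawn from different elements fail to unify).

  _⊕_ : Op₂ (Fin m)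
  i ⊕ j = _mod_ (toℕ i + toℕ j) m {{nonZeroIndex j}}

  _⊖_ : Op₂ (Fin m)
  i ⊖ j = _mod_ (toℕ i + (m ∸ toℕ j)) m {{nonZeroIndex j}}

  ⊕-comm : ∀ i j → i ⊕ j ≡ j ⊕ i
  ⊕-comm i j = cong (λ x → _mod_ x m {{nonZeroIndex j}}) (+-comm (toℕ i) (toℕ j))

  ⊕-⊖-cancel : ∀ i j → i ⊕ j ⊖ j ≡ i
  ⊕-⊖-cancel i j = toℕ-injective (begin
    toℕ (i ⊕ j ⊖ j)                             ≡⟨ toℕ-mod (toℕ (i ⊕ j) + (m ∸ toℕ j)) m ⟩
    (toℕ (i ⊕ j) + (m ∸ toℕ j)) % m             ≡⟨ cong (λ r → (r + (m ∸ toℕ j)) % m) (toℕ-mod (toℕ i + toℕ j) m) ⟩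
    ((toℕ i + toℕ j) % m + (m ∸ toℕ j)) % m     ≡⟨ [[x+a]%d+b]%d≡x (toℕ<n i) (m+[n∸m]≡n (<⇒≤ (toℕ<n j))) ⟩
    toℕ i                                       ∎)
    where instance _ = nonZeroIndex j

  ⊖-⊕-cancel : ∀ i j → i ⊖ j ⊕ j ≡ i
  ⊖-⊕-cancel i j = toℕ-injective (begin
    toℕ (i ⊖ j ⊕ j)                             ≡⟨ toℕ-mod (toℕ (i ⊖ j) + toℕ j) m ⟩
    (toℕ (i ⊖ j) + toℕ j) % m                   ≡⟨ cong (λ r → (r + toℕ j) % m) (toℕ-mod (toℕ i + (m ∸ toℕ j)) m) ⟩
    ((toℕ i + (m ∸ toℕ j)) % m + toℕ j) % m     ≡⟨ [[x+a]%d+b]%d≡x (toℕ<n i) (m∸n+n≡m (<⇒≤ (toℕ<n j))) ⟩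
    toℕ i                                       ∎)
    where instance _ = nonZeroIndex j

  ⊕-isQuasigroup : IsQuasigroup _≡_ _⊕_ (flip _⊖_) _⊖_
  ⊕-isQuasigroup = record
    { isMagma      = record { isEquivalence = isEquivalence ; ∙-cong = cong₂ _⊕_ }
    ; \\-cong      = cong₂ (flip _⊖_)
    ; //-cong      = cong₂ _⊖_
    ; leftDivides  = (λ x y → trans (⊕-comm x (y ⊖ x)) (⊖-⊕-cancel y x))
                   , (λ x y → trans (cong (_⊖ x) (⊕-comm x y)) (⊕-⊖-cancel y x))
    ; rightDivides = (λ x y → ⊖-⊕-cancel y x) , (λ x y → ⊕-⊖-cancel y x)
    }

quasigroup⇒rainbowDecomposition :
  ∀ {n} (T : Fin (n ∸ 1) → VEdge n) → IsSpanningTree T id →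
  ∀ {_∙_ _\\_ _//_ : Op₂ (Fin (n ∸ 1))} → IsQuasigroup _≡_ _∙_ _\\_ _//_ →
  RainbowDecomposition T
quasigroup⇒rainbowDecomposition {n} T T-isTree {_∙_} {_\\_} {_//_} Q = record
  { tree      = tree
  ; isTree    = λ k → record
      { distinct = cong proj₁
      ; acyclic  = IsSpanningTree.acyclic T-isTree
      ; spanning = IsSpanningTree.spanning T-isTree
      }
  ; rainbow   = λ k {j} {j′} e → trans (sym (leftDividesʳ k j)) (trans (cong (k \\_) e) (leftDividesʳ k j′))
  ; partition = inverseᵇ⇒bijective {f⁻¹ = owner}
      ( strictlyInverseˡ⇒inverseˡ (uncurry tree) (λ (j , c) → cong (j ,_) (rightDividesˡ j c))
      , strictlyInverseʳ⇒inverseʳ (uncurry tree) (λ (k , j) → cong (_, j) (rightDividesʳ j k)) )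
  }
  where
  open IsQuasigroup Q using (leftDividesʳ; rightDividesˡ; rightDividesʳ)

  tree : Fin (n ∸ 1) → Fin (n ∸ 1) → GEdge n
  tree k j = j , k ∙ j

  owner : GEdge n → Fin (n ∸ 1) × Fin (n ∸ 1)
  owner (j , c) = c // j , j

theorem3p6 : (n : ℕ) (T : Fin (n ∸ 1) → VEdge n)
    → IsSpanningTree T id
    → RainbowDecomposition T
theorem3p6 n T T-isTree = quasigroup⇒rainbowDecomposition T T-isTree ⊕-isQuasigroup
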